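{- Let $R$ be a finite commutative ring with unity whose cozero-divisor graph $\Gamma'(R)$ is connected. Let $X_1,\dots,X_k$ be the equivalence classes of the relation $\equiv$ on $V(\Gamma'(R))$ given by $x\equiv y\iff (x)=(y)$, let $x_i\in X_i$ be representatives, and let $\Upsilon'(R)$ be the subgraph of $\Gamma'(R)$ induced by $\{x_1,\dots,x_k\}$. Then \[ W(\Gamma'(R)) = 2\sum_{i=1}^{k}\binom{|X_i|}{2} + \sum_{1\le i<j\le k} |X_i||X_j|\, d_{\Upsilon'(R)}(x_i,x_j). \]
   Context: The cozero-divisor graph $\Gamma'(R)$ of a ring $R$ with unity is the simple undirected graph whose vertices are the non-zero non-unit elements of $R$, with distinct vertices $x,y$ adjacent iff $x\notin Ry$ and $y\notin Rx$. $(x)$ is the principal ideal generated by $x$. The Wiener index of a connected graph $\Gamma$ is $W(\Gamma)=\frac12\sum_{u,v\in V(\Gamma)} d(u,v)$, where $d$ is the shortest-path distance; $d_{\Upsilon'(R)}$ is the distance in $\Upsilon'(R)$. -}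

module Defs where

open import Level using (Level; _⊔_)
open import Algebra.Bundles using (CommutativeRing)
open import Data.Nat using (ℕ; zero; suc; _≤_) renaming (_+_ to _+ℕ_; _*_ to _*ℕ_)
open import Data.Nat.ListAction using (sum)
open import Data.Nat.Combinatorics using (_C_)
open import Data.List using (List; []; _∷_; map; length)
open import Data.List.Relation.Unary.Any using (Any)
open import Data.List.Relation.Unary.All using (All)
open import Data.List.Relation.Unary.AllPairs using (AllPairs)
open import Data.Product using (Σ; _×_; _,_; proj₁; proj₂; ∃)
open import Relation.Nullary using (¬_)
open import Relation.Binary using (Decidable)
open import Function.Bundles using (_⇔_)

-- Generic (simple) graphs on a setoid-carried vertex type.
-- V is an ambient type with equality _≈_, Adj an adjacency relation,
-- and P picks out the vertex set.

module Graph {a ℓ r : Level} {V : Set a} (_≈_ : V → V → Set ℓ)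
             (Adj : V → V → Set r) where

  data Walk : V → V → ℕ → Set (a ⊔ ℓ ⊔ r) where
    here : ∀ {u v} → u ≈ v → Walk u v 0
    step : ∀ {u w v n} → Adj u w → Walk w v n → Walk u v (suc n)

  module _ {p : Level} (P : V → Set p) where

    Connected : Set (a ⊔ ℓ ⊔ r ⊔ p)
    Connected = ∀ u v → P u → P v → ∃ λ n → Walk u v n

    IsDistance : (V → V → ℕ) → Set (a ⊔ ℓ ⊔ r ⊔ p)
    IsDistance d = ∀ u v → P u → P v →
      Walk u v (d u v) × (∀ n → Walk u v n → d u v ≤ n)

sumPairs : ∀ {a} {A : Set a} → (A → A → ℕ) → List A → ℕ
sumPairs f []       = 0
sumPairs f (x ∷ xs) = sum (map (f x) xs) +ℕ sumPairs f xs

module Cozero {c ℓ : Level} (R : CommutativeRing c ℓ) where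
  open CommutativeRing R

  _∈⟨_⟩ : Carrier → Carrier → Set (c ⊔ ℓ)
  x ∈⟨ y ⟩ = Σ Carrier λ r → x ≈ r * y

  IsUnit : Carrier → Set (c ⊔ ℓ)
  IsUnit x = Σ Carrier λ u → x * u ≈ 1#

  IsVertex : Carrier → Set (c ⊔ ℓ)
  IsVertex x = ¬ (x ≈ 0#) × ¬ IsUnit x

  Adj : Carrier → Carrier → Set (c ⊔ ℓ)
  Adj x y = IsVertex x × IsVertex y × ¬ (x ≈ y) × ¬ (x ∈⟨ y ⟩) × ¬ (y ∈⟨ x ⟩)

  SameIdeal : Carrier → Carrier → Set (c ⊔ ℓ)
  SameIdeal x y = x ∈⟨ y ⟩ × y ∈⟨ x ⟩

  record Finite : Set (c ⊔ ℓ) where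
    field
      _≈?_     : Decidable _≈_
      elems    : List Carrier
      complete : ∀ x → Any (x ≈_) elems
      unique   : AllPairs (λ a b → ¬ (a ≈ b)) elems

  IsVertexList : List Carrier → Set (c ⊔ ℓ)
  IsVertexList vs = (∀ x → IsVertex x ⇔ Any (x ≈_) vs)
                  × AllPairs (λ a b → ¬ (a ≈ b)) vs

  -- cls = [(x₁ , X₁) , … , (x_k , X_k)] lists the ≡-classes X_i (each as a
  -- duplicate-free list) together with a representative x_i ∈ X_i
  IsClassList : List (Carrier × List Carrier) → Set (c ⊔ ℓ)
  IsClassList cls =
      All (λ { (x , X) → IsVertex x
                       × (∀ y → (IsVertex y × SameIdeal y x) ⇔ Any (y ≈_) X)
                       × AllPairs (λ a b → ¬ (a ≈ b)) X }) cls
    × AllPairs (λ p q → ¬ SameIdeal (proj₁ p) (proj₁ q)) cls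
    × (∀ y → IsVertex y → Any (λ p → SameIdeal y (proj₁ p)) cls)

  IsRep : List (Carrier × List Carrier) → Carrier → Set (c ⊔ ℓ)
  IsRep cls x = Any (λ p → x ≈ proj₁ p) cls

  AdjΥ : List (Carrier × List Carrier) → Carrier → Carrier → Set (c ⊔ ℓ)
  AdjΥ cls x y = IsRep cls x × IsRep cls y × Adj x y

  open Graph _≈_ Adj public using () renaming (Connected to ConnectedΓ'; IsDistance to IsDistΓ')
  module GΥ (cls : List (Carrier × List Carrier)) = Graph _≈_ (AdjΥ cls)

  Wiener : List Carrier → (Carrier → Carrier → ℕ) → ℕ
  Wiener vs d = sumPairs d vs

  RHS : List (Carrier × List Carrier) → (Carrier → Carrier → ℕ) → ℕ
  RHS cls dΥ =
      2 *ℕ sum (map (λ p → length (proj₂ p) C 2) cls)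
    +ℕ sumPairs (λ p q → length (proj₂ p) *ℕ length (proj₂ q) *ℕ dΥ (proj₁ p) (proj₁ q)) cls

module Submission where

-- Adjacency in Γ'(R) depends only on the principal ideals of the endpoints, so vertices
-- generating the same ideal have the same neighbours. Two distinct vertices of one class are
-- not adjacent (each lies in the ideal of the other) yet share all their neighbours, which
-- puts them at distance exactly 2; and for vertices of different classes, replacing every vertex
-- of a walk by its representative (and back) matches walks in Γ'(R) with walks of the same
-- length in Υ'(R), so d(u, v) = d_Υ'(x_i, x_j). Listing the vertices class by class, the
-- Wiener sum splits into pairs inside each X_i, contributing 2·C(|X_i|, 2), and pairs across
-- X_i and X_j, contributing |X_i| |X_j| d_Υ'(x_i, x_j).

open import Defs
open import Level using (Level; _⊔_)
open import Algebra.Bundles using (CommutativeRing)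
open import Data.Nat using (ℕ; suc; _+_; _*_; _≤_; z≤n; s≤s)
open import Data.Nat.Properties using (≤-antisym; *-assoc; +-identityʳ; *-zeroʳ; +-commutativeSemigroup)
open import Data.Nat.ListAction using (sum)
open import Data.Nat.ListAction.Properties using (sum-++)
open import Data.Nat.Combinatorics using (_C_; nC1≡n; nCk+nC[k+1]≡[n+1]C[k+1])
open import Data.Nat.Tactic.RingSolver using (solve-∀)
open import Algebra.Properties.CommutativeSemigroup +-commutativeSemigroup using (x∙yz≈y∙xz)
open import Data.List using (List; []; _∷_; _++_; map; length; concatMap)
open import Data.List.Properties using (map-++)
open import Data.List.Membership.Propositional.Properties using (∈-lookup)
open import Data.List.Relation.Unary.All as All using (All; []; _∷_)
open import Data.List.Relation.Unary.All.Properties as All using (─⁺; All¬⇒¬Any)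
open import Data.List.Relation.Unary.Any as Any using (Any; here; there; _─_)
open import Data.List.Relation.Unary.Any.Properties as Any using (lookup-result; ¬Any[])
open import Data.List.Relation.Unary.AllPairs as AllPairs using (AllPairs; []; _∷_)
open import Data.List.Relation.Unary.AllPairs.Properties as AllPairs using ()
open import Data.Product using (Σ; _×_; _,_; proj₁; proj₂)
open import Data.Empty using (⊥-elim)
open import Relation.Nullary using (¬_)
open import Relation.Unary using (Pred)
open import Function.Base using (_∘_)
open import Function.Bundles using (Equivalence; _⇔_)
open import Relation.Binary.Bundles using (Setoid)
import Relation.Binary.Reasoning.Setoid as SetoidReasoning
open import Relation.Binary.Core using (Rel)
open import Relation.Binary.Definitions using (Symmetric)
open import Relation.Binary.Structures using (IsEquivalence)
open import Relation.Binary.PropositionalEquality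
  using (_≡_; refl; sym; trans; cong; cong₂; module ≡-Reasoning)

module _ {a q : Level} {A : Set a} {Q : Pred A q} where

  Any-zipWith-All : ∀ {r t} {R : Pred A r} {T : Pred A t} → (∀ {x} → Q x → R x → T x) →
                    {xs : List A} → All Q xs → Any R xs → Any T xs
  Any-zipWith-All f (qx ∷ _)  (here rx)  = here (f qx rx)
  Any-zipWith-All f (_ ∷ qxs) (there rx) = there (Any-zipWith-All f qxs rx)

  AllPairs-zipWith-All : ∀ {r t} {S : Rel A r} {T : Rel A t} →
                         (∀ {x y} → Q x → Q y → S x y → T x y) →
                         {xs : List A} → All Q xs → AllPairs S xs → AllPairs T xs
  AllPairs-zipWith-All f []         []         = []
  AllPairs-zipWith-All f (qx ∷ qxs) (sx ∷ sxs) =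
    All.zipWith (λ (qy , sxy) → f qx qy sxy) (qxs , sx) ∷ AllPairs-zipWith-All f qxs sxs

module _ {a} {A : Set a} where

  sum-map-++ : (g : A → ℕ) (xs ys : List A) →
               sum (map g (xs ++ ys)) ≡ sum (map g xs) + sum (map g ys)
  sum-map-++ g xs ys = trans (cong sum (map-++ g xs ys)) (sum-++ (map g xs) (map g ys))

  sum-map-const : {g : A → ℕ} {c : ℕ} {xs : List A} → All (λ x → g x ≡ c) xs →
                  sum (map g xs) ≡ length xs * c
  sum-map-const []       = refl
  sum-map-const (e ∷ es) = cong₂ _+_ e (sum-map-const es)

  sumCross : (A → A → ℕ) → List A → List A → ℕ
  sumCross f xs ys = sum (map (λ x → sum (map (f x) ys)) xs)

  sumPairs-++ : (f : A → A → ℕ) (xs ys : List A) →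
                sumPairs f (xs ++ ys) ≡ sumPairs f xs + sumPairs f ys + sumCross f xs ys
  sumPairs-++ f []       ys = sym (+-identityʳ (sumPairs f ys))
  sumPairs-++ f (x ∷ xs) ys = begin
    sum (map (f x) (xs ++ ys)) + sumPairs f (xs ++ ys)
      ≡⟨ cong₂ _+_ (sum-map-++ (f x) xs ys) (sumPairs-++ f xs ys) ⟩
    (fxs + fys) + (sumPairs f xs + sumPairs f ys + sumCross f xs ys)
      ≡⟨ rearrange fxs fys (sumPairs f xs) (sumPairs f ys) (sumCross f xs ys) ⟩
    (fxs + sumPairs f xs) + sumPairs f ys + (fys + sumCross f xs ys)
      ∎
    where
    open ≡-Reasoning
    fxs fys : ℕ
    fxs = sum (map (f x) xs)
    fys = sum (map (f x) ys)
    rearrange : ∀ a b c d e → (a + b) + (c + d + e) ≡ (a + c) + d + (b + e)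
    rearrange = solve-∀

  sumPairs-const : {f : A → A → ℕ} {c : ℕ} {xs : List A} → AllPairs (λ x y → f x y ≡ c) xs →
                   sumPairs f xs ≡ c * (length xs C 2)
  sumPairs-const {c = c} {xs = []}     []       = sym (*-zeroʳ c)
  sumPairs-const {c = c} {xs = x ∷ xs} (e ∷ es) = begin
    sum (map _ xs) + sumPairs _ xs  ≡⟨ cong₂ _+_ (sum-map-const e) (sumPairs-const es) ⟩
    length xs * c + c * (n C 2)     ≡⟨ distrib (length xs) c (n C 2) ⟩
    c * (length xs + n C 2)         ≡⟨ cong (λ m → c * (m + n C 2)) (sym (nC1≡n n)) ⟩
    c * (n C 1 + n C 2)             ≡⟨ cong (c *_) (nCk+nC[k+1]≡[n+1]C[k+1] n 1) ⟩
    c * (suc n C 2)                 ∎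
    where
    open ≡-Reasoning
    n : ℕ
    n = length xs
    distrib : ∀ a b c → a * b + b * c ≡ b * (a + c)
    distrib = solve-∀

  sumCross-++ʳ : (f : A → A → ℕ) (xs ys zs : List A) →
                 sumCross f xs (ys ++ zs) ≡ sumCross f xs ys + sumCross f xs zs
  sumCross-++ʳ f []       ys zs = refl
  sumCross-++ʳ f (x ∷ xs) ys zs = begin
    sum (map (f x) (ys ++ zs)) + sumCross f xs (ys ++ zs)
      ≡⟨ cong₂ _+_ (sum-map-++ (f x) ys zs) (sumCross-++ʳ f xs ys zs) ⟩
    (fys + fzs) + (sumCross f xs ys + sumCross f xs zs)
      ≡⟨ interchange fys fzs (sumCross f xs ys) (sumCross f xs zs) ⟩
    (fys + sumCross f xs ys) + (fzs + sumCross f xs zs)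
      ∎
    where
    open ≡-Reasoning
    fys fzs : ℕ
    fys = sum (map (f x) ys)
    fzs = sum (map (f x) zs)
    interchange : ∀ a b c d → (a + b) + (c + d) ≡ (a + c) + (b + d)
    interchange = solve-∀

  sumCross-const : {f : A → A → ℕ} {c : ℕ} {xs ys : List A} →
                   All (λ x → All (λ y → f x y ≡ c) ys) xs →
                   sumCross f xs ys ≡ length xs * (length ys * c)
  sumCross-const es = sum-map-const (All.map sum-map-const es)

module _ {a b} {A : Set a} {B : Set b} where

  sumCross-concatMap : {f : A → A → ℕ} {g : B × List A → ℕ}
    (xs : List A) (blocks : List (B × List A)) →
    All (λ q → All (λ x → All (λ y → f x y ≡ g q) (proj₂ q)) xs) blocks →
    sumCross f xs (concatMap proj₂ blocks) ≡
    sum (map (λ q → length xs * length (proj₂ q) * g q) blocks)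
  sumCross-concatMap xs []       []       =
    trans (sum-map-const (All.universal (λ _ → refl) xs)) (*-zeroʳ (length xs))
  sumCross-concatMap {f} {g} xs (q ∷ qs) (e ∷ es) = begin
    sumCross f xs (proj₂ q ++ concatMap proj₂ qs)
      ≡⟨ sumCross-++ʳ f xs (proj₂ q) (concatMap proj₂ qs) ⟩
    sumCross f xs (proj₂ q) + sumCross f xs (concatMap proj₂ qs)
      ≡⟨ cong₂ _+_ (trans (sumCross-const e) (sym (*-assoc (length xs) (length (proj₂ q)) _)))
                   (sumCross-concatMap xs qs es) ⟩
    length xs * length (proj₂ q) * g q + sum (map (λ q → length xs * length (proj₂ q) * g q) qs) ∎
    where open ≡-Reasoning

  sumPairs-concatMap : {f : A → A → ℕ} {g : B → B → ℕ} {c : ℕ} (blocks : List (B × List A)) →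
    All (λ p → AllPairs (λ x y → f x y ≡ c) (proj₂ p)) blocks →
    AllPairs (λ p q → All (λ x → All (λ y → f x y ≡ g (proj₁ p) (proj₁ q)) (proj₂ q)) (proj₂ p))
             blocks →
    sumPairs f (concatMap proj₂ blocks) ≡
    c * sum (map (λ p → length (proj₂ p) C 2) blocks) +
    sumPairs (λ p q → length (proj₂ p) * length (proj₂ q) * g (proj₁ p) (proj₁ q)) blocks
  sumPairs-concatMap {c = c} []       []       []       =
    sym (trans (+-identityʳ (c * 0)) (*-zeroʳ c))
  sumPairs-concatMap {f} {g} {c} (p ∷ ps) (e ∷ es) (h ∷ hs) = begin
    sumPairs f (proj₂ p ++ concatMap proj₂ ps)
      ≡⟨ sumPairs-++ f (proj₂ p) (concatMap proj₂ ps) ⟩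
    sumPairs f (proj₂ p) + sumPairs f (concatMap proj₂ ps) + sumCross f (proj₂ p) (concatMap proj₂ ps)
      ≡⟨ cong₂ _+_ (cong₂ _+_ (sumPairs-const e) (sumPairs-concatMap ps es hs))
                   (sumCross-concatMap (proj₂ p) ps h) ⟩
    c * (length (proj₂ p) C 2) + (c * S + T) + U
      ≡⟨ rearrange c (length (proj₂ p) C 2) S T U ⟩
    c * (length (proj₂ p) C 2 + S) + (U + T)
      ∎
    where
    open ≡-Reasoning
    S T U : ℕ
    S = sum (map (λ p → length (proj₂ p) C 2) ps)
    T = sumPairs (λ p q → length (proj₂ p) * length (proj₂ q) * g (proj₁ p) (proj₁ q)) ps
    U = sum (map (λ q → length (proj₂ p) * length (proj₂ q) * g (proj₁ p) (proj₁ q)) ps)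
    rearrange : ∀ c a s t u → c * a + (c * s + t) + u ≡ c * (a + s) + (u + t)
    rearrange = solve-∀

module _ {a ℓ p} (S : Setoid a ℓ) (P : Pred (Setoid.Carrier S) p) where
  open Setoid S using (_≈_) renaming (Carrier to A; refl to ≈-refl; sym to ≈-sym; trans to ≈-trans)
  open import Data.List.Membership.Setoid S using (_∈_)
  open import Data.List.Relation.Unary.Unique.Setoid S using (Unique)
  open import Data.List.Relation.Binary.Subset.Setoid S using (_⊆_)

  sum-map-─ : (g : A → ℕ) {v : A} {ws : List A} (i : v ∈ ws) →
              sum (map g ws) ≡ g (Any.lookup i) + sum (map g (ws ─ i))
  sum-map-─ g (here _)               = refl
  sum-map-─ g {ws = w ∷ _} (there i) =
    trans (cong (g w +_) (sum-map-─ g i)) (x∙yz≈y∙xz (g w) (g (Any.lookup i)) _)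

  sumPairs-─ : (f : A → A → ℕ) → (∀ {x y} → P x → P y → f x y ≡ f y x) →
               {v : A} {ws : List A} (i : v ∈ ws) → All P ws →
               sumPairs f ws ≡ sum (map (f (Any.lookup i)) (ws ─ i)) + sumPairs f (ws ─ i)
  sumPairs-─ f f-sym (here _) _                          = refl
  sumPairs-─ f f-sym {ws = w ∷ ws} (there i) (pw ∷ pws) = begin
    sum (map (f w) ws) + sumPairs f ws
      ≡⟨ cong₂ _+_ (sum-map-─ (f w) i) (sumPairs-─ f f-sym i pws) ⟩
    (f w l + sum (map (f w) rest)) + (sum (map (f l) rest) + sumPairs f rest)
      ≡⟨ cong (λ z → (z + sum (map (f w) rest)) + (sum (map (f l) rest) + sumPairs f rest))
              (f-sym pw (proj₁ (All.lookupAny pws i))) ⟩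
    (f l w + sum (map (f w) rest)) + (sum (map (f l) rest) + sumPairs f rest)
      ≡⟨ interchange (f l w) (sum (map (f w) rest)) (sum (map (f l) rest)) (sumPairs f rest) ⟩
    (f l w + sum (map (f l) rest)) + (sum (map (f w) rest) + sumPairs f rest)
      ∎
    where
    open ≡-Reasoning
    l : A
    l = Any.lookup i
    rest : List A
    rest = ws ─ i
    interchange : ∀ a b c d → (a + b) + (c + d) ≡ (a + c) + (b + d)
    interchange = solve-∀

  ∈-─⁺ : {v y : A} {ws : List A} (i : v ∈ ws) → y ∈ ws → ¬ y ≈ Any.lookup i → y ∈ (ws ─ i)
  ∈-─⁺ (here _)  (here e)  y≉l = ⊥-elim (y≉l e)
  ∈-─⁺ (here _)  (there j) y≉l = j
  ∈-─⁺ (there i) (here e)  y≉l = here e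
  ∈-─⁺ (there i) (there j) y≉l = there (∈-─⁺ i j y≉l)

  ∈-─⁻ : {v y : A} {ws : List A} (i : v ∈ ws) → y ∈ (ws ─ i) → y ∈ ws
  ∈-─⁻ (here _)  j         = there j
  ∈-─⁻ (there i) (here e)  = here e
  ∈-─⁻ (there i) (there j) = there (∈-─⁻ i j)

  Unique-─ : {v : A} {ws : List A} (i : v ∈ ws) → Unique ws → Unique (ws ─ i)
  Unique-─ (here _)  (_ ∷ u)   = u
  Unique-─ (there i) (w≉ ∷ u) = ─⁺ i w≉ ∷ Unique-─ i u

  lookup-apart-─ : {v : A} {ws : List A} (i : v ∈ ws) → Unique ws →
                   All (λ z → ¬ Any.lookup i ≈ z) (ws ─ i)
  lookup-apart-─ (here _)  (w≉ ∷ _) = w≉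
  lookup-apart-─ (there i) (w≉ ∷ u) =
    (λ e → proj₁ (All.lookupAny w≉ i) (≈-sym e)) ∷ lookup-apart-─ i u

  record SameEnumeration (vs ws : List A) : Set (a ⊔ ℓ ⊔ p) where
    field
      all-vs    : All P vs
      all-ws    : All P ws
      unique-vs : Unique vs
      unique-ws : Unique ws
      vs⊆ws     : vs ⊆ ws
      ws⊆vs     : ws ⊆ vs

  module _ {v : A} {vs ws : List A} (e : SameEnumeration (v ∷ vs) ws) where
    open SameEnumeration e

    position : v ∈ ws
    position = vs⊆ws (here ≈-refl)

    SameEnumeration-─ : SameEnumeration vs (ws ─ position)
    SameEnumeration-─ = record
      { all-vs    = All.tail all-vs
      ; all-ws    = ─⁺ position all-ws
      ; unique-vs = AllPairs.tail unique-vs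
      ; unique-ws = Unique-─ position unique-ws
      ; vs⊆ws     = λ j → ∈-─⁺ position (vs⊆ws (there j)) (y≉position j)
      ; ws⊆vs     = ─⊆vs
      }
      where
      y≉position : ∀ {y} → y ∈ vs → ¬ y ≈ Any.lookup position
      y≉position j y≈l = All¬⇒¬Any (AllPairs.head unique-vs)
                           (Any.map (≈-trans (≈-trans (lookup-result position) (≈-sym y≈l))) j)
      ─⊆vs : (ws ─ position) ⊆ vs
      ─⊆vs j with ws⊆vs (∈-─⁻ position j)
      ... | here y≈v = ⊥-elim (All¬⇒¬Any (lookup-apart-─ position unique-ws)
                                (Any.map (≈-trans (≈-sym (≈-trans y≈v (lookup-result position)))) j))
      ... | there k  = k

  sum-map-SameEnumeration : {g h : A → ℕ} → (∀ {x y} → P x → P y → x ≈ y → g x ≡ h y) →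
                            {vs ws : List A} → SameEnumeration vs ws → sum (map g vs) ≡ sum (map h ws)
  sum-map-SameEnumeration g≡h {[]} {[]}    e = refl
  sum-map-SameEnumeration g≡h {[]} {_ ∷ _} e =
    ⊥-elim (¬Any[] (SameEnumeration.ws⊆vs e (here ≈-refl)))
  sum-map-SameEnumeration {g} {h} g≡h {v ∷ vs} {ws} e = begin
    g v + sum (map g vs)
      ≡⟨ cong₂ _+_ (g≡h pv (proj₁ (All.lookupAny all-ws (position e))) (lookup-result (position e)))
                   (sum-map-SameEnumeration g≡h (SameEnumeration-─ e)) ⟩
    h (Any.lookup (position e)) + sum (map h (ws ─ position e))
      ≡⟨ sym (sum-map-─ h (position e)) ⟩
    sum (map h ws) ∎
    where
    open ≡-Reasoning
    open SameEnumeration e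
    pv : P v
    pv = All.head all-vs

  sumPairs-SameEnumeration : {f : A → A → ℕ} → (∀ {x y} → P x → P y → f x y ≡ f y x) →
    (∀ {x x′ y y′} → P x → P x′ → P y → P y′ → x ≈ x′ → y ≈ y′ → f x y ≡ f x′ y′) →
    {vs ws : List A} → SameEnumeration vs ws → sumPairs f vs ≡ sumPairs f ws
  sumPairs-SameEnumeration f-sym f-cong {[]} {[]}    e = refl
  sumPairs-SameEnumeration f-sym f-cong {[]} {_ ∷ _} e =
    ⊥-elim (¬Any[] (SameEnumeration.ws⊆vs e (here ≈-refl)))
  sumPairs-SameEnumeration {f} f-sym f-cong {v ∷ vs} {ws} e = begin
    sum (map (f v) vs) + sumPairs f vs
      ≡⟨ cong₂ _+_ (sum-map-SameEnumeration (λ px py → f-cong pv pl px py v≈l) e′)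
                   (sumPairs-SameEnumeration f-sym f-cong e′) ⟩
    sum (map (f (Any.lookup (position e))) (ws ─ position e)) + sumPairs f (ws ─ position e)
      ≡⟨ sym (sumPairs-─ f f-sym (position e) all-ws) ⟩
    sumPairs f ws ∎
    where
    open ≡-Reasoning
    open SameEnumeration e
    e′ : SameEnumeration vs (ws ─ position e)
    e′ = SameEnumeration-─ e
    pv : P v
    pv = All.head all-vs
    pl : P (Any.lookup (position e))
    pl = proj₁ (All.lookupAny all-ws (position e))
    v≈l : v ≈ Any.lookup (position e)
    v≈l = lookup-result (position e)

-- At u, v, IsDistance P d unfolds to IsLeast (Walk u v) (d u v).
IsLeast : ∀ {p} → Pred ℕ p → ℕ → Set p
IsLeast P n = P n × (∀ m → P m → n ≤ m)

IsLeast-unique : ∀ {p q} {P : Pred ℕ p} {Q : Pred ℕ q} {m n : ℕ} →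
                 IsLeast P m → IsLeast Q n → (∀ k → P k → Q k) → (∀ k → Q k → P k) → m ≡ n
IsLeast-unique (pm , m-least) (qn , n-least) P⇒Q Q⇒P =
  ≤-antisym (m-least _ (Q⇒P _ qn)) (n-least _ (P⇒Q _ pm))

module WalkProperties {a ℓ r} {V : Set a} {_≈_ : Rel V ℓ} (≈-isEquivalence : IsEquivalence _≈_)
                      {Adj : Rel V r} (Adj-sym : Symmetric Adj)
                      (Adj-respˡ : ∀ {x x′ y} → x ≈ x′ → Adj x y → Adj x′ y) where
  open IsEquivalence ≈-isEquivalence renaming (refl to ≈-refl; sym to ≈-sym; trans to ≈-trans)
  open Graph _≈_ Adj

  private variable
    u u′ v v′ w : V
    n : ℕ

  _▷_ : Walk u v n → Adj v w → Walk u w (suc n)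
  here u≈v  ▷ e = step (Adj-respˡ (≈-sym u≈v) e) (here ≈-refl)
  step e′ p ▷ e = step e′ (p ▷ e)

  reverse : Walk u v n → Walk v u n
  reverse (here u≈v) = here (≈-sym u≈v)
  reverse (step e p) = reverse p ▷ Adj-sym e

  Walk-respˡ : u ≈ u′ → Walk u v n → Walk u′ v n
  Walk-respˡ u≈u′ (here u≈v) = here (≈-trans (≈-sym u≈u′) u≈v)
  Walk-respˡ u≈u′ (step e p) = step (Adj-respˡ u≈u′ e) p

  Walk-resp : u ≈ u′ → v ≈ v′ → Walk u v n → Walk u′ v′ n
  Walk-resp u≈u′ v≈v′ p = reverse (Walk-respˡ v≈v′ (reverse (Walk-respˡ u≈u′ p)))

  module _ {p} {P : Pred V p} {d : V → V → ℕ} (d-dist : IsDistance P d) where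

    distance-sym : P u → P v → d u v ≡ d v u
    distance-sym {u} {v} pu pv =
      IsLeast-unique (d-dist u v pu pv) (d-dist v u pv pu) (λ _ → reverse) (λ _ → reverse)

    distance-cong : P u → P u′ → P v → P v′ → u ≈ u′ → v ≈ v′ → d u v ≡ d u′ v′
    distance-cong {u} {u′} {v} {v′} pu pu′ pv pv′ u≈u′ v≈v′ =
      IsLeast-unique (d-dist u v pu pv) (d-dist u′ v′ pu′ pv′)
                     (λ _ → Walk-resp u≈u′ v≈v′) (λ _ → Walk-resp (≈-sym u≈u′) (≈-sym v≈v′))

module CozeroProperties {c ℓ} (R : CommutativeRing c ℓ) where
  open CommutativeRing R
    using (Carrier; _≈_; 1#; 0#; isEquivalence; setoid; zeroʳ)
    renaming (_*_ to _·_; *-assoc to ·-assoc; *-comm to ·-comm; *-cong to ·-cong; *-congˡ to ·-congˡ;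
              *-identityˡ to ·-identityˡ; refl to ≈-refl; sym to ≈-sym; trans to ≈-trans)
  open Cozero R
  open Graph _≈_ Adj using (Walk; here; step)

  private variable
    a b u u′ v v′ x x′ y y′ z : Carrier
    n : ℕ

  ∈⟨⟩-trans : x ∈⟨ y ⟩ → y ∈⟨ z ⟩ → x ∈⟨ z ⟩
  ∈⟨⟩-trans {x} {y} {z} (r , x≈ry) (s , y≈sz) = r · s , (begin
    x             ≈⟨ x≈ry ⟩
    r · y         ≈⟨ ·-congˡ y≈sz ⟩
    r · (s · z)   ≈⟨ ·-assoc r s z ⟨
    (r · s) · z   ∎)
    where open SetoidReasoning setoid

  ≈⇒∈⟨⟩ : x ≈ y → x ∈⟨ y ⟩
  ≈⇒∈⟨⟩ {y = y} x≈y = 1# , ≈-trans x≈y (≈-sym (·-identityˡ y))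

  ≈⇒SameIdeal : x ≈ y → SameIdeal x y
  ≈⇒SameIdeal x≈y = ≈⇒∈⟨⟩ x≈y , ≈⇒∈⟨⟩ (≈-sym x≈y)

  SameIdeal-refl : SameIdeal x x
  SameIdeal-refl = ≈⇒SameIdeal ≈-refl

  SameIdeal-sym : SameIdeal x y → SameIdeal y x
  SameIdeal-sym (x∈y , y∈x) = y∈x , x∈y

  SameIdeal-trans : SameIdeal x y → SameIdeal y z → SameIdeal x z
  SameIdeal-trans (x∈y , y∈x) (y∈z , z∈y) = ∈⟨⟩-trans x∈y y∈z , ∈⟨⟩-trans z∈y y∈x

  IsVertex-resp-SameIdeal : SameIdeal x y → IsVertex x → IsVertex y
  IsVertex-resp-SameIdeal {x} {y} ((r , x≈ry) , (s , y≈sx)) (x≉0 , x-nonunit) = y≉0 , y-nonunit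
    where
    open SetoidReasoning setoid
    y≉0 : ¬ y ≈ 0#
    y≉0 y≈0 = x≉0 (begin
      x      ≈⟨ x≈ry ⟩
      r · y  ≈⟨ ·-congˡ y≈0 ⟩
      r · 0# ≈⟨ zeroʳ r ⟩
      0#     ∎)
    y-nonunit : ¬ IsUnit y
    y-nonunit (t , yt≈1) = x-nonunit (s · t , (begin
      x · (s · t)  ≈⟨ ·-assoc x s t ⟨
      (x · s) · t  ≈⟨ ·-cong (·-comm x s) ≈-refl ⟩
      (s · x) · t  ≈⟨ ·-cong y≈sx ≈-refl ⟨
      y · t        ≈⟨ yt≈1 ⟩
      1#           ∎))

  Adj-sym : Symmetric Adj
  Adj-sym (vx , vy , x≉y , x∉y , y∉x) = vy , vx , (λ y≈x → x≉y (≈-sym y≈x)) , y∉x , x∉y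

  Adj-resp-SameIdeal : SameIdeal x x′ → SameIdeal y y′ → Adj x y → Adj x′ y′
  Adj-resp-SameIdeal x~x′@(x∈x′ , x′∈x) y~y′@(y∈y′ , y′∈y) (vx , vy , x≉y , x∉y , y∉x) =
    IsVertex-resp-SameIdeal x~x′ vx , IsVertex-resp-SameIdeal y~y′ vy ,
    (λ x′≈y′ → x∉y (∈⟨⟩-trans x∈x′ (∈⟨⟩-trans (≈⇒∈⟨⟩ x′≈y′) y′∈y))) ,
    (λ x′∈y′ → x∉y (∈⟨⟩-trans x∈x′ (∈⟨⟩-trans x′∈y′ y′∈y))) ,
    (λ y′∈x′ → y∉x (∈⟨⟩-trans y∈y′ (∈⟨⟩-trans y′∈x′ x′∈x)))

  SameIdeal⇒¬Adj : SameIdeal x y → ¬ Adj x y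
  SameIdeal⇒¬Adj (x∈y , _) (_ , _ , _ , x∉y , _) = x∉y x∈y

  open WalkProperties isEquivalence Adj-sym
         (λ x≈x′ → Adj-resp-SameIdeal (≈⇒SameIdeal x≈x′) SameIdeal-refl) public

  Walk-resp-SameIdeal : SameIdeal u u′ → SameIdeal v v′ → Walk u v (suc n) → Walk u′ v′ (suc n)
  Walk-resp-SameIdeal u~u′ v~v′ (step e (here w≈v)) =
    step (Adj-resp-SameIdeal u~u′ (SameIdeal-trans (≈⇒SameIdeal w≈v) v~v′) e) (here ≈-refl)
  Walk-resp-SameIdeal u~u′ v~v′ (step e p@(step _ _)) =
    step (Adj-resp-SameIdeal u~u′ SameIdeal-refl e) (Walk-resp-SameIdeal SameIdeal-refl v~v′ p)

  same-class-walk-length : SameIdeal u v → ¬ u ≈ v → Walk u v n → 2 ≤ n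
  same-class-walk-length u~v u≉v (here u≈v)          = ⊥-elim (u≉v u≈v)
  same-class-walk-length u~v u≉v (step e (here w≈v)) =
    ⊥-elim (SameIdeal⇒¬Adj u~v (Adj-resp-SameIdeal SameIdeal-refl (≈⇒SameIdeal w≈v) e))
  same-class-walk-length u~v u≉v (step _ (step _ _)) = s≤s (s≤s z≤n)

  same-class-walk₂ : SameIdeal u v → ¬ u ≈ v → Walk u v n → Walk u v 2
  same-class-walk₂ u~v u≉v (here u≈v) = ⊥-elim (u≉v u≈v)
  same-class-walk₂ u~v u≉v (step e _) =
    step e (step (Adj-resp-SameIdeal SameIdeal-refl u~v (Adj-sym e)) (here ≈-refl))

  distance-same-class : {d : Carrier → Carrier → ℕ} → IsDistΓ' IsVertex d →
                        IsVertex u → IsVertex v → SameIdeal u v → ¬ u ≈ v → d u v ≡ 2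
  distance-same-class {u} {v} {d} d-dist vu vv u~v u≉v =
    ≤-antisym (least 2 (same-class-walk₂ u~v u≉v shortest)) (same-class-walk-length u~v u≉v shortest)
    where
    shortest : Walk u v (d u v)
    shortest = proj₁ (d-dist u v vu vv)
    least : ∀ m → Walk u v m → d u v ≤ m
    least = proj₂ (d-dist u v vu vv)

  module _ (cls : List (Carrier × List Carrier))
           (covers : ∀ y → IsVertex y → Any (λ p → SameIdeal y (proj₁ p)) cls) where
    open GΥ cls using () renaming (Walk to WalkΥ; here to hereΥ; step to stepΥ)

    representative : IsVertex y → Σ Carrier λ r → SameIdeal y r × IsRep cls r
    representative {y} vy =
      proj₁ (Any.lookup i) , lookup-result i , Any.map (λ { refl → ≈-refl }) (∈-lookup (Any.index i))
      where
      i : Any (λ p → SameIdeal y (proj₁ p)) cls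
      i = covers y vy

    project : SameIdeal u a → IsRep cls a → SameIdeal v b → IsRep cls b →
              Walk u v (suc n) → WalkΥ a b (suc n)
    project u~a ra v~b rb (step e (here w≈v)) =
      stepΥ (ra , rb , Adj-resp-SameIdeal u~a (SameIdeal-trans (≈⇒SameIdeal w≈v) v~b) e) (hereΥ ≈-refl)
    project u~a ra v~b rb (step e p@(step _ _)) with representative (proj₁ (proj₂ e))
    ... | r , w~r , rr = stepΥ (ra , rr , Adj-resp-SameIdeal u~a w~r e) (project w~r rr v~b rb p)

    forget : WalkΥ a b n → Walk a b n
    forget (hereΥ a≈b) = here a≈b
    forget (stepΥ e p) = step (proj₂ (proj₂ e)) (forget p)

    distance-distinct-classes : {d dΥ : Carrier → Carrier → ℕ} →
      IsDistΓ' IsVertex d → GΥ.IsDistance cls (IsRep cls) dΥ →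
      IsVertex u → IsVertex v → IsRep cls a → IsRep cls b →
      SameIdeal u a → SameIdeal v b → ¬ SameIdeal a b → d u v ≡ dΥ a b
    distance-distinct-classes {u} {v} {a} {b} d-dist dΥ-dist vu vv ra rb u~a v~b a≁b =
      IsLeast-unique (d-dist u v vu vv) (dΥ-dist a b ra rb) Γ′⇒Υ′ Υ′⇒Γ′
      where
      Γ′⇒Υ′ : ∀ n → Walk u v n → WalkΥ a b n
      Γ′⇒Υ′ _ (here u≈v)   = ⊥-elim (a≁b (SameIdeal-trans (SameIdeal-sym u~a)
                                         (SameIdeal-trans (≈⇒SameIdeal u≈v) v~b)))
      Γ′⇒Υ′ _ p@(step _ _) = project u~a ra v~b rb p
      Υ′⇒Γ′ : ∀ n → WalkΥ a b n → Walk u v n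
      Υ′⇒Γ′ _ (hereΥ a≈b)   = ⊥-elim (a≁b (≈⇒SameIdeal a≈b))
      Υ′⇒Γ′ _ p@(stepΥ _ _) = Walk-resp-SameIdeal (SameIdeal-sym u~a) (SameIdeal-sym v~b) (forget p)

  module ClassList (cls : List (Carrier × List Carrier)) (cls-ok : IsClassList cls) where

    InClassOf : Carrier × List Carrier → Carrier → Set (c ⊔ ℓ)
    InClassOf p u = IsVertex u × SameIdeal u (proj₁ p)

    IsClass : Carrier × List Carrier → Set (c ⊔ ℓ)
    IsClass p = IsVertex (proj₁ p)
              × (∀ y → InClassOf p y ⇔ Any (y ≈_) (proj₂ p))
              × AllPairs (λ a b → ¬ a ≈ b) (proj₂ p)

    classes : All IsClass cls
    classes = proj₁ cls-ok

    covers : ∀ y → IsVertex y → Any (λ p → SameIdeal y (proj₁ p)) cls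
    covers = proj₂ (proj₂ cls-ok)

    members : All (λ p → All (InClassOf p) (proj₂ p)) cls
    members = All.map (λ (_ , p-class , _) → All.tabulateₛ setoid (λ {u} → Equivalence.from (p-class u)))
                      classes

    representatives : All (λ p → IsRep cls (proj₁ p)) cls
    representatives = All.tabulate (Any.map (λ { refl → ≈-refl }))

    enumeration : {vs : List Carrier} → IsVertexList vs →
                  SameEnumeration setoid IsVertex vs (concatMap proj₂ cls)
    enumeration {vs} (vs-complete , vs-unique) = record
      { all-vs    = All.tabulateₛ setoid (λ {u} → Equivalence.from (vs-complete u))
      ; all-ws    = All.concat⁺ (All.map⁺ (All.map (All.map proj₁) members))
      ; unique-vs = vs-unique
      ; unique-ws = AllPairs.concat⁺ (All.map⁺ (All.map (proj₂ ∘ proj₂) classes))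
                      (AllPairs.map⁺ (AllPairs-zipWith-All apart members (proj₁ (proj₂ cls-ok))))
      ; vs⊆ws     = λ {y} y∈vs → in-class (Equivalence.from (vs-complete y) y∈vs)
      ; ws⊆vs     = λ {y} y∈ws →
                      Equivalence.to (vs-complete y) (in-class⁻ (Any.map⁻ (Any.concat⁻ _ y∈ws)))
      }
      where
      apart : ∀ {p q} → All (InClassOf p) (proj₂ p) → All (InClassOf q) (proj₂ q) →
              ¬ SameIdeal (proj₁ p) (proj₁ q) →
              All (λ u → All (λ v → ¬ u ≈ v) (proj₂ q)) (proj₂ p)
      apart mp mq p≁q = All.map (λ (_ , u~p) → All.map (λ (_ , v~q) u≈v →
        p≁q (SameIdeal-trans (SameIdeal-sym u~p) (SameIdeal-trans (≈⇒SameIdeal u≈v) v~q))) mq) mp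
      in-class : ∀ {y} → IsVertex y → Any (y ≈_) (concatMap proj₂ cls)
      in-class {y} vy = Any.concat⁺ (Any.map⁺ (Any-zipWith-All
        (λ (_ , p-class , _) y~p → Equivalence.to (p-class y) (vy , y~p)) classes (covers y vy)))
      in-class⁻ : ∀ {y} → Any (λ p → Any (y ≈_) (proj₂ p)) cls → IsVertex y
      in-class⁻ {y} i = let ((_ , p-class , _) , y∈p) = All.lookupAny classes i
                        in proj₁ (Equivalence.from (p-class y) y∈p)

    module _ {d : Carrier → Carrier → ℕ} (d-dist : IsDistΓ' IsVertex d) where

      distances-within-classes : All (λ p → AllPairs (λ u v → d u v ≡ 2) (proj₂ p)) cls
      distances-within-classes = All.zipWith
        (λ (mp , (_ , _ , p-unique)) → AllPairs-zipWith-All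
          (λ (vu , u~p) (vv , v~p) →
             distance-same-class d-dist vu vv (SameIdeal-trans u~p (SameIdeal-sym v~p)))
          mp p-unique)
        (members , classes)

      distances-across-classes : {dΥ : Carrier → Carrier → ℕ} → GΥ.IsDistance cls (IsRep cls) dΥ →
        AllPairs (λ p q → All (λ u → All (λ v → d u v ≡ dΥ (proj₁ p) (proj₁ q)) (proj₂ q)) (proj₂ p)) cls
      distances-across-classes dΥ-dist = AllPairs-zipWith-All
        (λ (mp , rp) (mq , rq) p≁q → All.map (λ (vu , u~p) → All.map (λ (vv , v~q) →
          distance-distinct-classes cls covers d-dist dΥ-dist vu vv rp rq u~p v~q p≁q) mq) mp)
        (All.zip (members , representatives)) (proj₁ (proj₂ cls-ok))

theorem2p5 : ∀ {c ℓ : Level} (R : CommutativeRing c ℓ) →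
    let open CommutativeRing R using (Carrier)
        open Cozero R
    in Finite →
       ConnectedΓ' IsVertex →
       (vs : List Carrier) → IsVertexList vs →
       (cls : List (Carrier × List Carrier)) → IsClassList cls →
       (d : Carrier → Carrier → ℕ) → IsDistΓ' IsVertex d →
       (dΥ : Carrier → Carrier → ℕ) → GΥ.IsDistance cls (IsRep cls) dΥ →
       Wiener vs d ≡ RHS cls dΥ
theorem2p5 R _ _ vs vs-ok cls cls-ok d d-dist dΥ dΥ-dist = begin
  sumPairs d vs
    ≡⟨ sumPairs-SameEnumeration setoid IsVertex (distance-sym d-dist) (distance-cong d-dist)
                                 (enumeration vs-ok) ⟩
  sumPairs d (concatMap proj₂ cls)
    ≡⟨ sumPairs-concatMap cls (distances-within-classes d-dist) (distances-across-classes d-dist dΥ-dist) ⟩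
  RHS cls dΥ ∎
  where
  open ≡-Reasoning
  open CommutativeRing R using (setoid)
  open Cozero R using (IsVertex; RHS)
  open CozeroProperties R
  open ClassList cls cls-ok
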